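{- Let $x=x_1\ldots x_m$ and $y=y_1\ldots y_n$ be strings, and consider the network $\mathrm{LCSNET}(x,y)$ with 0/1 inputs. Let $p$ be the number of ones among the bottom outputs of the cells $(m,j)$, $j\in[1:n]$. Then $p$ equals the number of zeros among the right outputs of the cells $(i,n)$, $i\in[1:m]$, and $p$ equals the length of a longest common subsequence of $x$ and $y$.
   Context: $[i:j]$ denotes $\{i,\ldots,j\}$. A subsequence of a string is obtained by deleting zero or more characters at arbitrary positions. Network $\mathrm{LCSNET}(x,y)$ with 0/1 inputs: a grid of cells $(i,j)$, $i\in[1:m]$, $j\in[1:n]$; cell $(i,j)$ is a match cell if $x_i=y_j$, otherwise a mismatch cell. Each cell has a left input, a top input, a right output and a bottom output; for $j<n$ the right output of $(i,j)$ is the left input of $(i,j+1)$, for $i<m$ the bottom output of $(i,j)$ is the top input of $(i+1,j)$. The left input of every cell $(i,1)$ is $1$ and the top input of every cell $(1,j)$ is $0$. A match cell passes its top input to its right output and its left input to its bottom output. A mismatch cell is a comparator returning the smaller of its two inputs at its bottom output and the larger at its right output. -}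

module Defs where

open import Data.Nat using (ℕ; zero; suc; _⊓_; _⊔_; _≤_)
open import Data.Nat.Properties using (_≟_)
open import Data.List using (List; []; _∷_; length; replicate)
open import Data.Product using (_×_; _,_; ∃-syntax)
open import Relation.Nullary using (yes; no)
open import Relation.Binary.Definitions using (DecidableEquality)
open import Relation.Binary.PropositionalEquality using (_≡_)
open import Data.List.Relation.Binary.Sublist.Propositional using (_⊆_)

-- Signals are natural numbers; the network is fed with 0/1 inputs only.

module LCSNet {A : Set} (_≟A_ : DecidableEquality A) where

  -- One cell with symbols a = x_i, b = y_j, left input l and top input t.
  -- Returns (right output , bottom output).
  cell : A → A → ℕ → ℕ → ℕ × ℕ
  cell a b l t with a ≟A b
  ... | yes _ = t , l
  ... | no  _ = l ⊔ t , l ⊓ t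

  -- One row i of the network: symbol a = x_i, string y, left input l of cell (i,1),
  -- top inputs of cells (i,1..n). Returns (bottom outputs of cells (i,1..n) ,
  -- right output of cell (i,n)).  (The right output of the last cell; for n = 0 the
  -- left input is returned, but that case has no cell (i,n).)
  row : A → List A → ℕ → List ℕ → List ℕ × ℕ
  row a (b ∷ ys) l (t ∷ ts) with cell a b l t
  ... | r , d with row a ys r ts
  ...   | ds , rr = d ∷ ds , rr
  row a _ l _ = [] , l

  -- Rows i..m of the network given the top inputs of row i.
  -- Returns (bottom outputs of the last row , list of right outputs of cells (i,n), …, (m,n)).
  rows : List A → List A → List ℕ → List ℕ × List ℕ
  rows [] y tops = tops , []
  rows (a ∷ xs) y tops with row a y 1 tops
  ... | bots , r with rows xs y bots
  ...   | final , rs = final , r ∷ rs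

  lcsnet : List A → List A → List ℕ × List ℕ
  lcsnet x y = rows x y (replicate (length y) 0)

  bottomOutputs : List A → List A → List ℕ
  bottomOutputs x y with lcsnet x y
  ... | b , _ = b

  rightOutputs : List A → List A → List ℕ
  rightOutputs x y with lcsnet x y
  ... | _ , r = r

countEq : ℕ → List ℕ → ℕ
countEq v [] = 0
countEq v (s ∷ ss) with s ≟ v
... | yes _ = suc (countEq v ss)
... | no  _ = countEq v ss

ones : List ℕ → ℕ
ones = countEq 1

zeros : List ℕ → ℕ
zeros = countEq 0

IsLCSLength : {A : Set} → List A → List A → ℕ → Set
IsLCSLength {A} x y k =
  (∃[ z ] (z ⊆ x × z ⊆ y × length z ≡ k)) ×
  ((z : List A) → z ⊆ x → z ⊆ y → length z ≤ k)

module Submission where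

-- Write lcs u v for the LCS length of u and v, computed by the usual dynamic
-- programme on LAST symbols; we realise "last symbol" by running the programme
-- on reversed prefixes, so lcs (a ∷ rp) (b ∷ rq) looks at x_i = a, y_j = b.
-- The key invariant is local: around cell (i,j) let D, U, W, N be the LCS
-- lengths of the prefix pairs (i-1,j-1), (i-1,j), (i,j-1), (i,j).  If the top
-- input is the bit U - D and the left input the bit 1 - (W - D), then the bottom
-- output is the bit N - W and the right output the bit 1 - (N - U)
-- (cell-correct).  Propagating this along a row (row-correct) and down the rows
-- (rows-correct) shows that the bottom outputs of row m are the increments of
-- j ↦ lcs(x, y[1..j]) and the right outputs of column n are the complementary
-- increments of i ↦ lcs(x[1..i], y).  Both sums telescope to lcs(x,y)
-- (ones-telescope, zeros-telescope).

open import Defs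
open import Data.Nat using (ℕ; suc; _+_; _⊓_; _⊔_; _≤_; z≤n; s≤s)
open import Data.Nat.Properties
  using (≤-trans; ≤-total; m≤n⇒m≤1+n; m≤m⊔n; m≤n⊔m; m≤n⇒m⊔n≡n; m≥n⇒m⊔n≡m; ⊔-idem; n≤1+n; +-suc; +-identityʳ; suc-injective)
open import Data.List using (List; []; _∷_; length; replicate; reverse; reverseAcc)
open import Data.List.Properties using (reverse-involutive; length-reverse)
open import Data.List.Relation.Binary.Sublist.Propositional using (_⊆_; []; _∷_; _∷ʳ_; minimum)
open import Data.List.Relation.Binary.Sublist.Propositional.Properties using (∷ˡ⁻; reverse⁺)
open import Data.Product using (_×_; _,_; ∃-syntax)
open import Data.Sum using (inj₁; inj₂)
open import Data.Empty using (⊥-elim)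
open import Relation.Nullary using (Dec; yes; no)
open import Relation.Binary.Definitions using (DecidableEquality)
open import Relation.Binary.PropositionalEquality using (_≡_; refl; sym; trans; cong; subst)

data Bit : ℕ → Set where
  bit0 : Bit 0
  bit1 : Bit 1

-- Increments f rq ys ts: moving the symbols of ys one by one onto the front of
-- the accumulator rq, the value of f grows by the successive bits ts.
data Increments {B : Set} (f : List B → ℕ) : List B → List B → List ℕ → Set where
  []   : ∀ {rq} → Increments f rq [] []
  step : ∀ {rq b ys t ts} → Bit t → f (b ∷ rq) ≡ t + f rq →
         Increments f (b ∷ rq) ys ts → Increments f rq (b ∷ ys) (t ∷ ts)

-- CoIncrements g rp xs rs: as above, but g grows by the complementary bits 1 - r.
data CoIncrements {B : Set} (g : List B → ℕ) : List B → List B → List ℕ → Set where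
  []   : ∀ {rp} → CoIncrements g rp [] []
  step : ∀ {rp a xs r rs} → Bit r → r + g (a ∷ rp) ≡ suc (g rp) →
         CoIncrements g (a ∷ rp) xs rs → CoIncrements g rp (a ∷ xs) (r ∷ rs)

ones-telescope : {B : Set} {f : List B → ℕ} {rq ys : List B} {ts : List ℕ} →
                 Increments f rq ys ts → ones ts + f rq ≡ f (reverseAcc rq ys)
ones-telescope [] = refl
ones-telescope {ts = _ ∷ ts} (step bit0 e inc) = trans (cong (ones ts +_) (sym e)) (ones-telescope inc)
ones-telescope {f = f} {rq} {ts = _ ∷ ts} (step bit1 e inc) =
  trans (sym (+-suc (ones ts) (f rq))) (trans (cong (ones ts +_) (sym e)) (ones-telescope inc))

zeros-telescope : {B : Set} {g : List B → ℕ} {rp xs : List B} {rs : List ℕ} →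
                  CoIncrements g rp xs rs → zeros rs + g rp ≡ g (reverseAcc rp xs)
zeros-telescope [] = refl
zeros-telescope {g = g} {rp} {rs = _ ∷ rs} (step bit0 e co) =
  trans (sym (+-suc (zeros rs) (g rp))) (trans (cong (zeros rs +_) (sym e)) (zeros-telescope co))
zeros-telescope {rs = _ ∷ rs} (step bit1 e co) =
  trans (cong (zeros rs +_) (sym (suc-injective e))) (zeros-telescope co)

isLCSLength-reverse : {B : Set} {x y : List B} {k : ℕ} →
                      IsLCSLength (reverse x) (reverse y) k → IsLCSLength x y k
isLCSLength-reverse {x = x} {y} {k} ((z , z⊆x , z⊆y , len) , longest) =
  (reverse z , unreverse z⊆x , unreverse z⊆y , trans (length-reverse z) len) ,
  λ w w⊆x w⊆y → subst (_≤ k) (length-reverse w) (longest (reverse w) (reverse⁺ w⊆x) (reverse⁺ w⊆y))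
  where
  unreverse : {u v : List _} → u ⊆ reverse v → reverse u ⊆ v
  unreverse {v = v} u⊆v = subst (_ ⊆_) (reverse-involutive v) (reverse⁺ u⊆v)

module Correctness {A : Set} (_≟A_ : DecidableEquality A) where
  open LCSNet _≟A_

  lcsStep : {P : Set} → Dec P → ℕ → ℕ → ℕ → ℕ
  lcsStep (yes _) D U W = suc D
  lcsStep (no _)  D U W = U ⊔ W

  lcs : List A → List A → ℕ
  lcs []       _        = 0
  lcs (a ∷ as) []       = 0
  lcs (a ∷ as) (b ∷ bs) = lcsStep (a ≟A b) (lcs as bs) (lcs as (b ∷ bs)) (lcs (a ∷ as) bs)

  lcs-[]ʳ : (as : List A) → lcs as [] ≡ 0
  lcs-[]ʳ []       = refl
  lcs-[]ʳ (a ∷ as) = refl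

  lcs-upper : (as bs : List A) {z : List A} → z ⊆ as → z ⊆ bs → length z ≤ lcs as bs
  lcs-upper []       bs       []        _         = z≤n
  lcs-upper (a ∷ as) []       _         []        = z≤n
  lcs-upper (a ∷ as) (b ∷ bs) z⊆as z⊆bs with a ≟A b
  lcs-upper (a ∷ as) (b ∷ bs) (.a ∷ʳ p) (.b ∷ʳ q) | yes _ = m≤n⇒m≤1+n (lcs-upper as bs p q)
  lcs-upper (a ∷ as) (b ∷ bs) (.a ∷ʳ p) (refl ∷ q) | yes _ = s≤s (lcs-upper as bs (∷ˡ⁻ p) q)
  lcs-upper (a ∷ as) (b ∷ bs) (refl ∷ p) (.b ∷ʳ q) | yes _ = s≤s (lcs-upper as bs p (∷ˡ⁻ q))
  lcs-upper (a ∷ as) (b ∷ bs) (refl ∷ p) (refl ∷ q) | yes _ = s≤s (lcs-upper as bs p q)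
  lcs-upper (a ∷ as) (b ∷ bs) (.a ∷ʳ p) q | no _ =
    ≤-trans (lcs-upper as (b ∷ bs) p q) (m≤m⊔n _ _)
  lcs-upper (a ∷ as) (b ∷ bs) (refl ∷ p) (.b ∷ʳ q) | no _ =
    ≤-trans (lcs-upper (a ∷ as) bs (refl ∷ p) q) (m≤n⊔m _ _)
  lcs-upper (a ∷ as) (b ∷ bs) (refl ∷ p) (refl ∷ q) | no a≢b = ⊥-elim (a≢b refl)

  CommonOfLength : List A → List A → ℕ → Set
  CommonOfLength as bs k = ∃[ z ] (z ⊆ as × z ⊆ bs × length z ≡ k)

  witness-step : (a b : A) {as bs : List A} (a≟b : Dec (a ≡ b)) →
                 CommonOfLength as bs (lcs as bs) →
                 CommonOfLength as (b ∷ bs) (lcs as (b ∷ bs)) →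
                 CommonOfLength (a ∷ as) bs (lcs (a ∷ as) bs) →
                 CommonOfLength (a ∷ as) (b ∷ bs)
                   (lcsStep a≟b (lcs as bs) (lcs as (b ∷ bs)) (lcs (a ∷ as) bs))
  witness-step a .a (yes refl) (z , p , q , e) _ _ = a ∷ z , refl ∷ p , refl ∷ q , cong suc e
  witness-step a b {as} {bs} (no _) _ (z , p , q , e) (z′ , p′ , q′ , e′)
    with ≤-total (lcs (a ∷ as) bs) (lcs as (b ∷ bs))
  ... | inj₁ W≤U = z , a ∷ʳ p , q , trans e (sym (m≥n⇒m⊔n≡m W≤U))
  ... | inj₂ U≤W = z′ , p′ , b ∷ʳ q′ , trans e′ (sym (m≤n⇒m⊔n≡n U≤W))

  lcs-witness : (as bs : List A) → CommonOfLength as bs (lcs as bs)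
  lcs-witness []       bs       = [] , [] , minimum bs , refl
  lcs-witness (a ∷ as) []       = [] , minimum (a ∷ as) , [] , refl
  lcs-witness (a ∷ as) (b ∷ bs) =
    witness-step a b (a ≟A b) (lcs-witness as bs) (lcs-witness as (b ∷ bs)) (lcs-witness (a ∷ as) bs)

  lcs-isLCSLength : (as bs : List A) → IsLCSLength as bs (lcs as bs)
  lcs-isLCSLength as bs = lcs-witness as bs , λ z → lcs-upper as bs

  -- Output specification of a cell (i,j), with U, W, N the LCS lengths of the
  -- prefix pairs (i-1,j), (i,j-1), (i,j): the bottom output d is N - W and the
  -- right output r is 1 - (N - U).
  CellSpec : ℕ → ℕ → ℕ → ℕ × ℕ → Set
  CellSpec U W N (r , d) = (Bit d × N ≡ d + W) × (Bit r × r + N ≡ suc U)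

  match-correct : {l t D U W : ℕ} → Bit l → l + W ≡ suc D → Bit t → U ≡ t + D →
                  CellSpec U W (suc D) (t , l)
  match-correct {t = t} {D} bl eW bt eU = (bl , sym eW) , (bt , trans (+-suc t D) (cong suc (sym eU)))

  comparator-correct : {l t D U W : ℕ} → Bit l → l + W ≡ suc D → Bit t → U ≡ t + D →
                       CellSpec U W (U ⊔ W) (l ⊔ t , l ⊓ t)
  comparator-correct {D = D} bit0 refl bit0 refl = (bit0 , D⊔1+D) , (bit0 , D⊔1+D)
    where D⊔1+D = m≤n⇒m⊔n≡n (n≤1+n D)
  comparator-correct {D = D} bit0 refl bit1 refl = (bit0 , ⊔-idem (suc D)) , (bit1 , cong suc (⊔-idem (suc D)))
  comparator-correct {D = D} bit1 refl bit0 refl = (bit0 , ⊔-idem D) , (bit1 , cong suc (⊔-idem D))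
  comparator-correct {D = D} bit1 refl bit1 refl = (bit1 , 1+D⊔D) , (bit1 , cong suc 1+D⊔D)
    where 1+D⊔D = m≥n⇒m⊔n≡m (n≤1+n D)

  cell-correct : (a b : A) {l t D U W : ℕ} → Bit l → l + W ≡ suc D → Bit t → U ≡ t + D →
                 CellSpec U W (lcsStep (a ≟A b) D U W) (cell a b l t)
  cell-correct a b with a ≟A b
  ... | yes _ = match-correct
  ... | no  _ = comparator-correct

  -- Output specification of row i = a, with rp the reversed x[1..i-1], rq the
  -- reversed processed part of y and ys the remaining part: the bottom outputs
  -- are the increments of lcs (a ∷ rp) and the final right output is the
  -- complementary increment from lcs rp to lcs (a ∷ rp).
  RowSpec : A → List A → List A → List A → List ℕ × ℕ → Set
  RowSpec a rp rq ys (ds , r) =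
    Increments (lcs (a ∷ rp)) rq ys ds ×
    Bit r × r + lcs (a ∷ rp) (reverseAcc rq ys) ≡ suc (lcs rp (reverseAcc rq ys))

  row-correct : (a : A) (rp rq ys : List A) {l : ℕ} {ts : List ℕ} →
                Increments (lcs rp) rq ys ts → Bit l → l + lcs (a ∷ rp) rq ≡ suc (lcs rp rq) →
                RowSpec a rp rq ys (row a ys l ts)
  row-correct a rp rq [] [] bl eW = [] , bl , eW
  row-correct a rp rq (b ∷ ys) {l} {t ∷ ts} (step bt eU inc) bl eW
    with cell a b l t | cell-correct a b bl eW bt eU
  ... | r , d | (bd , eN) , (br , eR) with row a ys r ts | row-correct a rp (b ∷ rq) ys inc br eR
  ...   | ds , r′ | inc′ , br′ , eR′ = step bd eN inc′ , br′ , eR′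

  initial-increments : (rq ys : List A) → Increments (lcs []) rq ys (replicate (length ys) 0)
  initial-increments rq []       = []
  initial-increments rq (b ∷ ys) = step bit0 refl (initial-increments (b ∷ rq) ys)

  module _ (y : List A) where

    -- Output specification of the rows xs below the reversed prefix rp of x:
    -- the last bottom outputs are the increments of lcs (full reversed x), the
    -- right outputs the complementary increments of rp ↦ lcs rp (reverse y).
    RowsSpec : List A → List A → List ℕ × List ℕ → Set
    RowsSpec rp xs (bottoms , rights) =
      Increments (lcs (reverseAcc rp xs)) [] y bottoms ×
      CoIncrements (λ rp′ → lcs rp′ (reverse y)) rp xs rights

    rows-correct : (xs rp : List A) {tops : List ℕ} →
                   Increments (lcs rp) [] y tops → RowsSpec rp xs (rows xs y tops)
    rows-correct []       rp inc = inc , []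
    rows-correct (a ∷ xs) rp {tops} inc
      with row a y 1 tops | row-correct a rp [] y inc bit1 (cong suc (sym (lcs-[]ʳ rp)))
    ... | bots , r | inc′ , br , eR with rows xs y bots | rows-correct xs (a ∷ rp) inc′
    ...   | bottoms , rights | incᶠ , co = incᶠ , step br eR co

  outputs-spec : (x y : List A) → RowsSpec y [] x (bottomOutputs x y , rightOutputs x y)
  outputs-spec x y with lcsnet x y | rows-correct y x [] (initial-increments [] y)
  ... | bottoms , rights | spec = spec

  -- Both output counts equal the LCS length of the reversed strings: the sums
  -- telescope from lcs (reverse x) [] = 0 and lcs [] (reverse y) = 0 respectively.
  network-correct : (x y : List A) →
                    (ones (bottomOutputs x y) ≡ lcs (reverse x) (reverse y)) ×
                    (zeros (rightOutputs x y) ≡ lcs (reverse x) (reverse y))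
  network-correct x y with outputs-spec x y
  ... | inc , co =
    trans (sym (+-identityʳ _)) (trans (cong (ones (bottomOutputs x y) +_) (sym (lcs-[]ʳ (reverse x))))
                                       (ones-telescope inc)) ,
    trans (sym (+-identityʳ _)) (zeros-telescope co)

corollary1 : {A : Set} (_≟A_ : DecidableEquality A) (x y : List A) →
    let open LCSNet _≟A_ in
    (ones (bottomOutputs x y) ≡ zeros (rightOutputs x y)) ×
    IsLCSLength x y (ones (bottomOutputs x y))
corollary1 _≟A_ x y with Correctness.network-correct _≟A_ x y
... | ones≡lcs , zeros≡lcs =
  trans ones≡lcs (sym zeros≡lcs) ,
  subst (IsLCSLength x y) (sym ones≡lcs) (isLCSLength-reverse (lcs-isLCSLength (reverse x) (reverse y)))
  where open Correctness _≟A_ using (lcs-isLCSLength)
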